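{- Let $(\Gamma,B)$ be a balanced graph with $\Gamma$ a finite $3$-valent graph, and suppose the minimal multiplicity of a vertex of $\Gamma$ is $0$. Then the number of vertices of $\Gamma$ of multiplicity $0$ is even.
   Context: $\mathbb{Z}_2$ denotes the $2$-adic integers and $\nu_2$ the $2$-adic valuation ($\nu_2(0)=\infty$). A $3$-valent graph $\Gamma$ (multiple edges allowed) is regarded as directed by replacing each undirected edge by two opposite directed edges $e^+,e^-$; each vertex is the terminal vertex of exactly three directed edges. A balancing function $B$ assigns to each directed edge a vector $B(e)=(B_x(e),B_y(e))\in\mathbb{Z}_2\oplus\mathbb{Z}_2$ with $B(e^+)+B(e^-)=0$ and $B(e_1)+B(e_2)+B(e_3)=0$ for the three directed edges $e_1,e_2,e_3$ terminating at any vertex; $(\Gamma,B)$ is a balanced graph. The multiplicity of a vertex $v$ with terminating edges $e_1,e_2,e_3$ is $m(v)=\nu_2(B_x(e_1)B_y(e_2)-B_y(e_1)B_x(e_2))\in\mathbb{Z}_{\ge0}\cup\{\infty\}$. -}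

module Defs where

open import Data.Nat as ℕ using (ℕ; zero; suc; _^_)
open import Data.Integer as ℤ using (ℤ; +_; _+_; _*_; _-_; -_)
open import Data.Integer.Divisibility.Signed using (_∣_; _∣?_; ∣m∣n⇒∣m+n; ∣m⇒∣-m; ∣n⇒∣m*n; ∣m⇒∣m*n; divides)
open import Data.Integer.Tactic.RingSolver using (solve-∀)
open import Data.Fin using (Fin; zero; suc)
open import Data.Fin.Properties using (suc-injective)
open import Data.List using (length; filter)
open import Data.List.Base using (allFin)
open import Data.Product using (Σ; _×_; _,_; ∃)
open import Data.Maybe using (Maybe; just; nothing)
open import Relation.Nullary using (¬_; Dec; yes; no)
open import Relation.Nullary.Decidable using (¬?)
open import Relation.Binary.PropositionalEquality using (_≡_; _≢_; subst; sym)
open import Function.Definitions using (Injective)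

-- 2-adic integers ℤ₂, modelled as coherent sequences of integers:
-- a 2-adic integer is a sequence (a₀, a₁, …) of integers with
-- a_{n+1} ≡ a_n (mod 2^n); a_n is its class in ℤ/2^n.

pow2 : ℕ → ℤ
pow2 n = + (2 ^ n)

record ℤ₂ : Set where
  constructor mkℤ₂
  field
    seq : ℕ → ℤ
    coh : ∀ n → pow2 n ∣ (seq (suc n) - seq n)
open ℤ₂ public

infix 4 _≈₂_
_≈₂_ : ℤ₂ → ℤ₂ → Set
x ≈₂ y = ∀ n → pow2 n ∣ (seq x n - seq y n)

private
  id-add : ∀ a b c d → (a + c) - (b + d) ≡ (a - b) + (c - d)
  id-add = solve-∀
  id-mul : ∀ a b c d → (a * c) - (b * d) ≡ a * (c - d) + (a - b) * d
  id-mul = solve-∀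
  id-neg : ∀ a b → (- a) - (- b) ≡ - (a - b)
  id-neg = solve-∀

0₂ : ℤ₂
0₂ = mkℤ₂ (λ _ → + 0) (λ n → divides (+ 0) Eq.refl)
  where import Relation.Binary.PropositionalEquality as Eq

infixl 6 _+₂_ _-₂_
infixl 7 _*₂_

_+₂_ : ℤ₂ → ℤ₂ → ℤ₂
x +₂ y = mkℤ₂ (λ n → seq x n + seq y n) λ n →
  subst (pow2 n ∣_) (sym (id-add (seq x (suc n)) (seq x n) (seq y (suc n)) (seq y n)))
        (∣m∣n⇒∣m+n (coh x n) (coh y n))

-₂_ : ℤ₂ → ℤ₂
-₂ x = mkℤ₂ (λ n → - seq x n) λ n →
  subst (pow2 n ∣_) (sym (id-neg (seq x (suc n)) (seq x n))) (∣m⇒∣-m (coh x n))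

_-₂_ : ℤ₂ → ℤ₂ → ℤ₂
x -₂ y = x +₂ (-₂ y)

_*₂_ : ℤ₂ → ℤ₂ → ℤ₂
x *₂ y = mkℤ₂ (λ n → seq x n * seq y n) λ n →
  subst (pow2 n ∣_) (sym (id-mul (seq x (suc n)) (seq x n) (seq y (suc n)) (seq y n)))
        (∣m∣n⇒∣m+n (∣n⇒∣m*n (seq x (suc n)) (coh y n)) (∣m⇒∣m*n (seq y n) (coh x n)))

-- 2-adic valuation ν₂ : ℤ₂ → ℕ ∪ {∞}, given as a relation.
-- ν₂ x = k (finite)  iff  2^k ∣ x  and  2^(k+1) ∤ x,
-- where "2^k ∣ x" in ℤ₂ means a_k ≡ 0 (mod 2^k).
-- ν₂ x = ∞ (nothing)  iff  x ≈ 0.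

ℕ∞ : Set
ℕ∞ = Maybe ℕ

_∣₂_ : ℕ → ℤ₂ → Set
k ∣₂ x = pow2 k ∣ seq x k

ν₂≡ : ℤ₂ → ℕ∞ → Set
ν₂≡ x (just k) = k ∣₂ x × ¬ (suc k ∣₂ x)
ν₂≡ x nothing  = ∀ k → k ∣₂ x

ν₂≡0? : (x : ℤ₂) → Dec (ν₂≡ x (just 0))
ν₂≡0? x with pow2 1 ∣? seq x 1
... | yes p = no λ { (_ , q) → q p }
... | no ¬p = yes (divides (seq x 0) (solve0 (seq x 0)) , ¬p)
  where
  solve0 : ∀ a → a ≡ a * + 1
  solve0 = solve-∀

-- Finite 3-valent graphs (multiple edges allowed), as directed graphs:
-- V vertices, D directed edges, each undirected edge {e⁺,e⁻} is an
-- orbit of the fixed-point-free involution rev; tgt gives the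
-- terminal vertex; inc v enumerates (bijectively) the three directed
-- edges terminating at v.

record ThreeValentGraph : Set where
  field
    V D  : ℕ
    rev  : Fin D → Fin D
    rev-invol : ∀ e → rev (rev e) ≡ e
    rev-nofix : ∀ e → rev e ≢ e
    tgt  : Fin D → Fin V
    inc  : Fin V → Fin 3 → Fin D
    inc-tgt : ∀ v i → tgt (inc v i) ≡ v
    inc-inj : ∀ v → Injective _≡_ _≡_ (inc v)
    inc-surj : ∀ e → Σ (Fin 3) λ i → inc (tgt e) i ≡ e
open ThreeValentGraph public

Vec₂ : Set
Vec₂ = ℤ₂ × ℤ₂

record Balancing (Γ : ThreeValentGraph) : Set where
  field
    Bx By : Fin (D Γ) → ℤ₂
    anti-x : ∀ e → Bx e +₂ Bx (rev Γ e) ≈₂ 0₂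
    anti-y : ∀ e → By e +₂ By (rev Γ e) ≈₂ 0₂
    bal-x  : ∀ v → Bx (inc Γ v zero) +₂ Bx (inc Γ v (suc zero)) +₂ Bx (inc Γ v (suc (suc zero))) ≈₂ 0₂
    bal-y  : ∀ v → By (inc Γ v zero) +₂ By (inc Γ v (suc zero)) +₂ By (inc Γ v (suc (suc zero))) ≈₂ 0₂
open Balancing public

det : (Γ : ThreeValentGraph) → Balancing Γ → Fin (V Γ) → ℤ₂
det Γ B v = Bx B e₁ *₂ By B e₂ -₂ By B e₁ *₂ Bx B e₂
  where
  e₁ = inc Γ v zero
  e₂ = inc Γ v (suc zero)

mult≡ : (Γ : ThreeValentGraph) → Balancing Γ → Fin (V Γ) → ℕ∞ → Set
mult≡ Γ B v k = ν₂≡ (det Γ B v) k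

#mult0 : (Γ : ThreeValentGraph) → Balancing Γ → ℕ
#mult0 Γ B = length (filter (λ v → ν₂≡0? (det Γ B v)) (allFin (V Γ)))

-- Reduce everything modulo 2 and put xy(e) := Bx(e) By(e) mod 2. A vertex has multiplicity 0
-- exactly when its determinant is odd, and since the three vectors at v sum to zero, modulo 2
-- that determinant is the sum of xy over the three edges ending at v. Summing over all vertices
-- gives the sum of xy over all directed edges, which vanishes because B(e⁻) = −B(e⁺) makes
-- xy(e⁺) = xy(e⁻).
module Submission where

open import Defs
open import Data.Nat using (ℕ)
open import Data.Nat.Divisibility using (_∣_)
open import Data.Fin using (Fin)
open import Data.Maybe using (just)
open import Data.Product using (Σ)

open import Algebra.Bundles using (CommutativeRing)
open import Data.Bool using (Bool; true; false; _∧_; _xor_)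
open import Data.Bool.Properties
  using (xor-∧-commutativeRing; xor-identityʳ; xor-same; ∧-identityʳ; ∧-distribʳ-xor)
open import Data.Bool.Solver using (module xor-∧-Solver)
open import Data.Fin using (zero; suc; _<?_)
open import Data.Fin.Permutation using (permutation)
open import Data.Fin.Properties using (_≟_; <-cmp)
open import Data.Integer using (ℤ; +_; _+_; _*_; _-_; -_)
open import Data.Integer.DivMod using (_%ℕ_; _/ℕ_; n%ℕd<d; a≡a%ℕn+[a/ℕn]*n)
open import Data.Integer.Divisibility.Signed as ℤ∣ using (divides; _∣?_)
open import Data.Integer.Tactic.RingSolver using (solve-∀)
import Data.Integer.Properties as ℤ
import Data.Nat as ℕ
import Data.Nat.Divisibility as ℕ
open import Data.List using (length; filter; tabulate)
open import Data.Product using (_,_)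
open import Function using (_∘_; mk⇔)
open import Function.Definitions using (Injective)
open import Relation.Binary using (tri<; tri≈; tri>)
open import Relation.Binary.PropositionalEquality
open import Relation.Nullary using (¬_; yes; no; does; contradiction)
open import Relation.Nullary.Decidable using (dec-true; dec-false; does-⇔)
open import Relation.Unary using (Pred; Decidable)

open CommutativeRing xor-∧-commutativeRing using (semiring)
open import Algebra.Properties.Semiring.Sum semiring
  using ( sum; sum-syntax; sum-cong-≗; sum-replicate-zero; ∑-comm; ∑-distrib-+
        ; *-distribʳ-sum; sum-permute)
open xor-∧-Solver using (solve; _:+_; _:*_; _:=_)
open ≡-Reasoning

-- Sums over 𝔽₂ = (Bool, xor, ∧)

δ : ∀ {n} → Fin n → Fin n → Bool
δ i j = does (i ≟ j)

δ-comm : ∀ {n} (i j : Fin n) → δ i j ≡ δ j i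
δ-comm i j = does-⇔ (mk⇔ sym sym) (i ≟ j) (j ≟ i)

δ-injective : ∀ {m n} {f : Fin m → Fin n} → Injective _≡_ _≡_ f →
              ∀ i j → δ (f i) (f j) ≡ δ i j
δ-injective {f = f} f-inj i j = does-⇔ (mk⇔ f-inj (cong f)) (f i ≟ f j) (i ≟ j)

∑-δ : ∀ {n} (a : Fin n) (f : Fin n → Bool) → ∑[ i < n ] (δ a i ∧ f i) ≡ f a
∑-δ {ℕ.suc n} zero    f = trans (cong (f zero xor_) (sum-replicate-zero n)) (xor-identityʳ (f zero))
∑-δ {ℕ.suc n} (suc a) f = ∑-δ a (f ∘ suc)

∑-δʳ : ∀ {n} (a : Fin n) → ∑[ i < n ] δ i a ≡ true
∑-δʳ {n} a = begin
  ∑[ i < n ] δ i a            ≡⟨ sum-cong-≗ (λ i → trans (δ-comm i a) (sym (∧-identityʳ (δ a i)))) ⟩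
  ∑[ i < n ] (δ a i ∧ true)   ≡⟨ ∑-δ a (λ _ → true) ⟩
  true                        ∎

≢⇒<-xor-> : ∀ {n} {i j : Fin n} → i ≢ j → does (i <? j) xor does (j <? i) ≡ true
≢⇒<-xor-> {i = i} {j} i≢j with <-cmp i j
... | tri< i<j _ j≮i rewrite dec-true (i <? j) i<j | dec-false (j <? i) j≮i = refl
... | tri≈ _ i≡j _ = contradiction i≡j i≢j
... | tri> i≮j _ j<i rewrite dec-false (i <? j) i≮j | dec-true (j <? i) j<i = refl

-- k keeps h on each e lying below its partner r e, so that h = k + k ∘ r.
∑-involution-invariant : ∀ {n} (r : Fin n → Fin n) → (∀ e → r (r e) ≡ e) → (∀ e → r e ≢ e) →
                         (h : Fin n → Bool) → (∀ e → h (r e) ≡ h e) → ∑[ e < n ] h e ≡ false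
∑-involution-invariant {n} r r-invol r-nofix h h-inv = begin
  ∑[ e < n ] h e                ≡⟨ sum-cong-≗ h≡k+k∘r ⟩
  ∑[ e < n ] (k e xor k (r e))  ≡⟨ ∑-distrib-+ k (k ∘ r) ⟩
  sum k xor sum (k ∘ r)         ≡⟨ cong (sum k xor_) (sum-permute k (permutation r r r-invol r-invol)) ⟨
  sum k xor sum k               ≡⟨ xor-same (sum k) ⟩
  false                         ∎
  where
  k : Fin n → Bool
  k e = does (e <? r e) ∧ h e

  h≡k+k∘r : ∀ e → h e ≡ k e xor k (r e)
  h≡k+k∘r e = begin
    h e                                          ≡⟨ cong (_∧ h e) (≢⇒<-xor-> (r-nofix e ∘ sym)) ⟨
    (does (e <? r e) xor does (r e <? e)) ∧ h e  ≡⟨ ∧-distribʳ-xor (h e) (does (e <? r e)) _ ⟩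
    k e xor (does (r e <? e) ∧ h e)              ≡⟨ cong₂ (λ e′ x → k e xor (does (r e <? e′) ∧ x))
                                                          (r-invol e) (h-inv e) ⟨
    k e xor k (r e)                              ∎

module Fibres {m d k} (tgt : Fin d → Fin m) (inc : Fin m → Fin k → Fin d)
  (inc-tgt : ∀ v i → tgt (inc v i) ≡ v)
  (inc-inj : ∀ v → Injective _≡_ _≡_ (inc v))
  (inc-surj : ∀ e → Σ (Fin k) λ i → inc (tgt e) i ≡ e) where

  δ-tgt : ∀ e v → δ (tgt e) v ≡ ∑[ i < k ] δ (inc v i) e
  δ-tgt e v with tgt e ≟ v
  ... | no tgt-e≢v = sym (trans (sum-cong-≗ δ-inc) (sum-replicate-zero k))
    where
    δ-inc : ∀ i → δ (inc v i) e ≡ false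
    δ-inc i = dec-false (inc v i ≟ e)
                λ inc-v-i≡e → tgt-e≢v (trans (cong tgt (sym inc-v-i≡e)) (inc-tgt v i))
  ... | yes refl with inc-surj e
  ... | i₀ , inc-i₀≡e = sym (trans (sum-cong-≗ δ-inc) (∑-δʳ i₀))
    where
    δ-inc : ∀ i → δ (inc (tgt e) i) e ≡ δ i i₀
    δ-inc i = trans (cong (δ (inc (tgt e) i)) (sym inc-i₀≡e)) (δ-injective (inc-inj (tgt e)) i i₀)

  ∑-fibres : (h : Fin d → Bool) → ∑[ v < m ] ∑[ i < k ] h (inc v i) ≡ ∑[ e < d ] h e
  ∑-fibres h = sym (begin
    ∑[ e < d ] h e
      ≡⟨ sum-cong-≗ (λ e → ∑-δ (tgt e) (λ _ → h e)) ⟨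
    ∑[ e < d ] ∑[ v < m ] (δ (tgt e) v ∧ h e)
      ≡⟨ ∑-comm (λ e v → δ (tgt e) v ∧ h e) ⟩
    ∑[ v < m ] ∑[ e < d ] (δ (tgt e) v ∧ h e)
      ≡⟨ sum-cong-≗ (λ v → sum-cong-≗ (λ e → cong (_∧ h e) (δ-tgt e v))) ⟩
    ∑[ v < m ] ∑[ e < d ] (∑[ i < k ] δ (inc v i) e ∧ h e)
      ≡⟨ sum-cong-≗ (λ v → sum-cong-≗ (λ e → *-distribʳ-sum (h e) (λ i → δ (inc v i) e))) ⟩
    ∑[ v < m ] ∑[ e < d ] ∑[ i < k ] (δ (inc v i) e ∧ h e)
      ≡⟨ sum-cong-≗ (λ v → ∑-comm (λ e i → δ (inc v i) e ∧ h e)) ⟩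
    ∑[ v < m ] ∑[ i < k ] ∑[ e < d ] (δ (inc v i) e ∧ h e)
      ≡⟨ sum-cong-≗ (λ v → sum-cong-≗ (λ i → ∑-δ (inc v i) h)) ⟩
    ∑[ v < m ] ∑[ i < k ] h (inc v i)
      ∎)

-- Congruence modulo 2 and the parity map ℤ → 𝔽₂

infix 4 _≡₂_
record _≡₂_ (a b : ℤ) : Set where
  constructor 2∣-
  field 2∣a-b : + 2 ℤ∣.∣ a - b

≡₂-by : ∀ {a b c} → a - b ≡ c → + 2 ℤ∣.∣ c → a ≡₂ b
≡₂-by a-b≡c 2∣c = 2∣- (subst (+ 2 ℤ∣.∣_) (sym a-b≡c) 2∣c)

≡₂-sym : ∀ {a b} → a ≡₂ b → b ≡₂ a
≡₂-sym {a} {b} (2∣- 2∣a-b) = ≡₂-by (regroup a b) (ℤ∣.∣m⇒∣-m 2∣a-b)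
  where
  regroup : ∀ a b → b - a ≡ - (a - b)
  regroup = solve-∀

≡₂-trans : ∀ {a b c} → a ≡₂ b → b ≡₂ c → a ≡₂ c
≡₂-trans {a} {b} {c} (2∣- 2∣a-b) (2∣- 2∣b-c) = ≡₂-by (regroup a b c) (ℤ∣.∣m∣n⇒∣m+n 2∣a-b 2∣b-c)
  where
  regroup : ∀ a b c → a - c ≡ (a - b) + (b - c)
  regroup = solve-∀

+-cong-≡₂ : ∀ {a b c d} → a ≡₂ b → c ≡₂ d → a + c ≡₂ b + d
+-cong-≡₂ {a} {b} {c} {d} (2∣- 2∣a-b) (2∣- 2∣c-d) =
  ≡₂-by (regroup a b c d) (ℤ∣.∣m∣n⇒∣m+n 2∣a-b 2∣c-d)
  where
  regroup : ∀ a b c d → (a + c) - (b + d) ≡ (a - b) + (c - d)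
  regroup = solve-∀

*-cong-≡₂ : ∀ {a b c d} → a ≡₂ b → c ≡₂ d → a * c ≡₂ b * d
*-cong-≡₂ {a} {b} {c} {d} (2∣- 2∣a-b) (2∣- 2∣c-d) =
  ≡₂-by (regroup a b c d) (ℤ∣.∣m∣n⇒∣m+n (ℤ∣.∣n⇒∣m*n a 2∣c-d) (ℤ∣.∣m⇒∣m*n d 2∣a-b))
  where
  regroup : ∀ a b c d → a * c - b * d ≡ a * (c - d) + (a - b) * d
  regroup = solve-∀

-‿cong-≡₂ : ∀ {a b} → a ≡₂ b → - a ≡₂ - b
-‿cong-≡₂ {a} {b} (2∣- 2∣a-b) = ≡₂-by (regroup a b) (ℤ∣.∣m⇒∣-m 2∣a-b)
  where
  regroup : ∀ a b → - a - - b ≡ - (a - b)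
  regroup = solve-∀

r+q*2≡₂r : ∀ r q → r + q * + 2 ≡₂ r
r+q*2≡₂r r q = ≡₂-by (regroup r q) (divides q refl)
  where
  regroup : ∀ r q → (r + q * + 2) - r ≡ q * + 2
  regroup = solve-∀

bit : Bool → ℤ
bit false = + 0
bit true  = + 1

bit-injective-≡₂ : ∀ {a b} → bit a ≡₂ bit b → a ≡ b
bit-injective-≡₂ {false} {false} _          = refl
bit-injective-≡₂ {true}  {true}  _          = refl
bit-injective-≡₂ {false} {true}  (2∣- 2∣-1) = contradiction (ℕ.∣1⇒≡1 (ℤ∣.∣⇒∣ᵤ 2∣-1)) λ ()
bit-injective-≡₂ {true}  {false} (2∣- 2∣1)  = contradiction (ℕ.∣1⇒≡1 (ℤ∣.∣⇒∣ᵤ 2∣1)) λ ()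

bit-xor : ∀ a b → bit a + bit b ≡₂ bit (a xor b)
bit-xor false false = 2∣- (divides (+ 0) refl)
bit-xor false true  = 2∣- (divides (+ 0) refl)
bit-xor true  false = 2∣- (divides (+ 0) refl)
bit-xor true  true  = 2∣- (divides (+ 1) refl)

bit-∧ : ∀ a b → bit a * bit b ≡ bit (a ∧ b)
bit-∧ false false = refl
bit-∧ false true  = refl
bit-∧ true  false = refl
bit-∧ true  true  = refl

bit-neg : ∀ a → - bit a ≡₂ bit a
bit-neg false = 2∣- (divides (+ 0) refl)
bit-neg true  = 2∣- (divides (- + 1) refl)

parity : ℤ → Bool
parity z = z %ℕ 2 ℕ.≡ᵇ 1

parity-spec : ∀ z → z ≡₂ bit (parity z)
parity-spec z with z %ℕ 2 | n%ℕd<d z 2 | a≡a%ℕn+[a/ℕn]*n z 2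
... | 0 | _ | z≡r+q*2 = subst (_≡₂ + 0) (sym z≡r+q*2) (r+q*2≡₂r (+ 0) (z /ℕ 2))
... | 1 | _ | z≡r+q*2 = subst (_≡₂ + 1) (sym z≡r+q*2) (r+q*2≡₂r (+ 1) (z /ℕ 2))
... | ℕ.suc (ℕ.suc _) | ℕ.s≤s (ℕ.s≤s ()) | _

parity-unique : ∀ {z b} → z ≡₂ bit b → parity z ≡ b
parity-unique {z} z≡b = bit-injective-≡₂ (≡₂-trans (≡₂-sym (parity-spec z)) z≡b)

parity-cong : ∀ {a b} → a ≡₂ b → parity a ≡ parity b
parity-cong {b = b} a≡b = parity-unique (≡₂-trans a≡b (parity-spec b))

parity-+ : ∀ a b → parity (a + b) ≡ parity a xor parity b
parity-+ a b = parity-unique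
  (≡₂-trans (+-cong-≡₂ (parity-spec a) (parity-spec b)) (bit-xor (parity a) (parity b)))

parity-* : ∀ a b → parity (a * b) ≡ parity a ∧ parity b
parity-* a b = parity-unique
  (subst (a * b ≡₂_) (bit-∧ (parity a) (parity b)) (*-cong-≡₂ (parity-spec a) (parity-spec b)))

parity-neg : ∀ a → parity (- a) ≡ parity a
parity-neg a = parity-unique (≡₂-trans (-‿cong-≡₂ (parity-spec a)) (bit-neg (parity a)))

parity≡false⇒2∣ : ∀ {z} → parity z ≡ false → + 2 ℤ∣.∣ z
parity≡false⇒2∣ {z} even =
  subst (+ 2 ℤ∣.∣_) (ℤ.+-identityʳ z) (_≡₂_.2∣a-b (subst (λ b → z ≡₂ bit b) even (parity-spec z)))

2∤⇒parity≡true : ∀ {z} → ¬ (+ 2 ℤ∣.∣ z) → parity z ≡ true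
2∤⇒parity≡true {z} 2∤z with parity z in eq
... | true  = refl
... | false = contradiction (parity≡false⇒2∣ eq) 2∤z

parity-length-filter : ∀ {a p} {A : Set a} {P : Pred A p} (P? : Decidable P) {n} (f : Fin n → A) →
                       parity (+ length (filter P? (tabulate f))) ≡ ∑[ i < n ] does (P? (f i))
parity-length-filter P? {ℕ.zero}  f = refl
parity-length-filter P? {ℕ.suc n} f with does (P? (f zero))
... | true  = trans (parity-+ (+ 1) (+ length (filter P? (tabulate (f ∘ suc)))))
                    (cong (true xor_) (parity-length-filter P? (f ∘ suc)))
... | false = parity-length-filter P? (f ∘ suc)

mod₂ : ℤ₂ → Bool
mod₂ x = parity (seq x 1)

mod₂-cong : ∀ {x y} → x ≈₂ y → mod₂ x ≡ mod₂ y
mod₂-cong {x} {y} x≈y = parity-cong {seq x 1} {seq y 1} (2∣- (x≈y 1))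

mod₂-+ : ∀ x y → mod₂ (x +₂ y) ≡ mod₂ x xor mod₂ y
mod₂-+ x y = parity-+ (seq x 1) (seq y 1)

mod₂-cross : ∀ x y z w → mod₂ (x *₂ y -₂ z *₂ w) ≡ (mod₂ x ∧ mod₂ y) xor (mod₂ z ∧ mod₂ w)
mod₂-cross x y z w = begin
  parity (a * b + - (c * d))                       ≡⟨ parity-+ (a * b) (- (c * d)) ⟩
  parity (a * b) xor parity (- (c * d))            ≡⟨ cong₂ _xor_ (parity-* a b) (parity-neg (c * d)) ⟩
  (parity a ∧ parity b) xor parity (c * d)         ≡⟨ cong ((parity a ∧ parity b) xor_) (parity-* c d) ⟩
  (parity a ∧ parity b) xor (parity c ∧ parity d)  ∎
  where
  a = seq x 1
  b = seq y 1
  c = seq z 1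
  d = seq w 1

does-ν₂≡0? : ∀ x → does (ν₂≡0? x) ≡ mod₂ x
does-ν₂≡0? x with pow2 1 ∣? seq x 1
... | yes 2∣x = sym (parity-unique {seq x 1} (≡₂-by (ℤ.+-identityʳ (seq x 1)) 2∣x))
... | no 2∤x  = sym (2∤⇒parity≡true 2∤x)

xor≡false⇒≡ : ∀ {a b} → a xor b ≡ false → a ≡ b
xor≡false⇒≡ {false} {false} _ = refl
xor≡false⇒≡ {true}  {true}  _ = refl

mod₂-+≈0₂ : ∀ x y → x +₂ y ≈₂ 0₂ → mod₂ x ≡ mod₂ y
mod₂-+≈0₂ x y x+y≈0 = xor≡false⇒≡ (trans (sym (mod₂-+ x y)) (mod₂-cong {x +₂ y} {0₂} x+y≈0))

mod₂-+-+≈0₂ : ∀ x y z → x +₂ y +₂ z ≈₂ 0₂ → mod₂ z ≡ mod₂ x xor mod₂ y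
mod₂-+-+≈0₂ x y z x+y+z≈0 = trans (sym (mod₂-+≈0₂ (x +₂ y) z x+y+z≈0)) (mod₂-+ x y)

det-xor : ∀ x₀ x₁ y₀ y₁ →
          (x₀ ∧ y₁) xor (y₀ ∧ x₁) ≡ (x₀ ∧ y₀) xor ((x₁ ∧ y₁) xor ((x₀ xor x₁) ∧ (y₀ xor y₁)))
det-xor = solve 4 (λ x₀ x₁ y₀ y₁ →
  (x₀ :* y₁) :+ (y₀ :* x₁) := (x₀ :* y₀) :+ ((x₁ :* y₁) :+ ((x₀ :+ x₁) :* (y₀ :+ y₁)))) refl

module _ (Γ : ThreeValentGraph) (B : Balancing Γ) where

  xy : Fin (D Γ) → Bool
  xy e = mod₂ (Bx B e) ∧ mod₂ (By B e)

  xy-rev : ∀ e → xy (rev Γ e) ≡ xy e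
  xy-rev e = sym (cong₂ _∧_ (mod₂-+≈0₂ (Bx B e) (Bx B (rev Γ e)) (anti-x B e))
                            (mod₂-+≈0₂ (By B e) (By B (rev Γ e)) (anti-y B e)))

  mod₂-det : ∀ v → mod₂ (det Γ B v) ≡ ∑[ i < 3 ] xy (inc Γ v i)
  mod₂-det v = begin
    mod₂ (det Γ B v)                                ≡⟨ mod₂-cross (Bx B e₀) (By B e₁) (By B e₀) (Bx B e₁) ⟩
    (x₀ ∧ y₁) xor (y₀ ∧ x₁)                         ≡⟨ det-xor x₀ x₁ y₀ y₁ ⟩
    xy e₀ xor (xy e₁ xor ((x₀ xor x₁) ∧ (y₀ xor y₁))) ≡⟨ cong (λ t → xy e₀ xor (xy e₁ xor t)) xy-e₂ ⟨
    xy e₀ xor (xy e₁ xor xy e₂)                     ≡⟨ cong (λ t → xy e₀ xor (xy e₁ xor t))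
                                                             (xor-identityʳ (xy e₂)) ⟨
    ∑[ i < 3 ] xy (inc Γ v i)                       ∎
    where
    e₀ = inc Γ v zero
    e₁ = inc Γ v (suc zero)
    e₂ = inc Γ v (suc (suc zero))
    x₀ = mod₂ (Bx B e₀)
    x₁ = mod₂ (Bx B e₁)
    y₀ = mod₂ (By B e₀)
    y₁ = mod₂ (By B e₁)

    xy-e₂ : xy e₂ ≡ (x₀ xor x₁) ∧ (y₀ xor y₁)
    xy-e₂ = cong₂ _∧_ (mod₂-+-+≈0₂ (Bx B e₀) (Bx B e₁) (Bx B e₂) (bal-x B v))
                      (mod₂-+-+≈0₂ (By B e₀) (By B e₁) (By B e₂) (bal-y B v))

  open Fibres (tgt Γ) (inc Γ) (inc-tgt Γ) (inc-inj Γ) (inc-surj Γ) using (∑-fibres)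

  -- With id in place of λ v → v, inferring the implicit arguments below takes minutes.
  parity-#mult0 : parity (+ #mult0 Γ B) ≡ false
  parity-#mult0 = begin
    parity (+ #mult0 Γ B)                   ≡⟨ parity-length-filter (λ v → ν₂≡0? (det Γ B v)) (λ v → v) ⟩
    ∑[ v < V Γ ] does (ν₂≡0? (det Γ B v))   ≡⟨ sum-cong-≗ (does-ν₂≡0? ∘ det Γ B) ⟩
    ∑[ v < V Γ ] mod₂ (det Γ B v)           ≡⟨ sum-cong-≗ mod₂-det ⟩
    ∑[ v < V Γ ] ∑[ i < 3 ] xy (inc Γ v i)  ≡⟨ ∑-fibres xy ⟩
    ∑[ e < D Γ ] xy e                       ≡⟨ ∑-involution-invariant (rev Γ) (rev-invol Γ) (rev-nofix Γ)
                                                                      xy xy-rev ⟩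
    false                                   ∎

-- The existence of a vertex of multiplicity 0 is not needed.
corollary1 : (Γ : ThreeValentGraph) (B : Balancing Γ) →
    Σ (Fin (V Γ)) (λ v → mult≡ Γ B v (just 0)) →
    2 ∣ #mult0 Γ B
corollary1 Γ B _ = ℤ∣.∣⇒∣ᵤ (parity≡false⇒2∣ {+ #mult0 Γ B} (parity-#mult0 Γ B))
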